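{- Let $G$ be a digraph such that $M_G=(E(G),\mathrm{Mult}(G))$ is a matroid. Then the circuits of $M_G$ are exactly the edge sets of the subgraphs of $G$ that are linear sinks, linear sources, or coherently oriented cycles (including loops).
   Context: Digraphs: finite, at most one edge $(v,w)$ from $v$ to $w$ for distinct $v,w$, loops allowed. A multipath is a spanning subgraph each of whose connected components is a vertex or a simple path (sequence of non-loop edges, target of each = source of next, no repeated vertex, not closing into a cycle); $\mathrm{Mult}(G)$ is the set of multipaths identified with their edge sets. A linear sink: three distinct vertices $v_0,v_1,v_2$ with edges $(v_0,v_1),(v_2,v_1)$; a linear source: edges $(v_1,v_0),(v_1,v_2)$. A coherently oriented cycle is a loop or a subgraph with distinct vertices $v_1,\dots,v_n$ ($n\ge2$) and edges $(v_i,v_{i+1})$, $(v_n,v_1)$. A circuit of a matroid is a minimal dependent (non-independent) set. -}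

module Defs where

open import Data.Nat using (ℕ; zero; suc; _<_)
open import Data.Fin using (Fin; zero; suc; inject₁; fromℕ)
open import Data.Fin.Subset using (Subset; ⊥; _⊆_; _⊂_; _∈_; _∉_; _∪_; ⁅_⁆; ∣_∣)
open import Data.List using (List; _∷_; []; _++_; concat)
open import Data.List.Relation.Unary.Unique.Propositional using (Unique)
import Data.List.Membership.Propositional as LM
open import Data.Product using (Σ; ∃; ∃-syntax; _×_; _,_)
open import Data.Sum using (_⊎_)
open import Relation.Binary.PropositionalEquality using (_≡_; _≢_)
open import Relation.Nullary using (¬_)
open import Function.Bundles using (_⇔_)

record Digraph : Set where
  field
    n   : ℕ
    m   : ℕ
    src : Fin m → Fin n
    tgt : Fin m → Fin n
    simple : ∀ e f → src e ≡ src f → tgt e ≡ tgt f → e ≡ f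

open Digraph public

Consecutive : {A : Set} → List A → A → A → Set
Consecutive p v w = ∃[ xs ] ∃[ ys ] (p ≡ xs ++ (v ∷ w ∷ ys))

-- A spanning subgraph with edge set S is a multipath iff its
-- connected components are single vertices or simple paths, i.e. iff there is
-- a family of vertex sequences (the components, each a path v0 → v1 → … → vk,
-- k = 0 for an isolated vertex) such that every vertex of G occurs in exactly
-- one sequence exactly once, the edges of S are exactly the edges joining
-- consecutive vertices of a sequence, and all those edges exist in G.
IsMultipath : (G : Digraph) → Subset (m G) → Set
IsMultipath G S =
  ∃[ ps ] ( Unique (concat ps)
          × (∀ v → v LM.∈ concat ps)
          × (∀ p → p LM.∈ ps → ∀ v w → Consecutive p v w →
               ∃[ e ] (src G e ≡ v × tgt G e ≡ w))
          × (∀ e → (e ∈ S) ⇔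
               (∃[ p ] (p LM.∈ ps × Consecutive p (src G e) (tgt G e)))) )

record IsMatroid {m : ℕ} (I : Subset m → Set) : Set where
  field
    empty      : I ⊥
    hereditary : ∀ {A B} → A ⊆ B → I B → I A
    exchange   : ∀ {A B} → I A → I B → ∣ A ∣ < ∣ B ∣ →
                 ∃[ e ] (e ∈ B × e ∉ A × I (A ∪ ⁅ e ⁆))

IsCircuit : {m : ℕ} (I : Subset m → Set) → Subset m → Set
IsCircuit I C = ¬ I C × (∀ D → D ⊂ C → I D)

IsLinearSink : (G : Digraph) → Subset (m G) → Set
IsLinearSink G C =
  ∃[ v₀ ] ∃[ v₁ ] ∃[ v₂ ] ∃[ a ] ∃[ b ]
    ( v₀ ≢ v₁ × v₁ ≢ v₂ × v₀ ≢ v₂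
    × src G a ≡ v₀ × tgt G a ≡ v₁ × src G b ≡ v₂ × tgt G b ≡ v₁
    × (∀ e → (e ∈ C) ⇔ (e ≡ a ⊎ e ≡ b)) )

IsLinearSource : (G : Digraph) → Subset (m G) → Set
IsLinearSource G C =
  ∃[ v₀ ] ∃[ v₁ ] ∃[ v₂ ] ∃[ a ] ∃[ b ]
    ( v₀ ≢ v₁ × v₁ ≢ v₂ × v₀ ≢ v₂
    × src G a ≡ v₁ × tgt G a ≡ v₀ × src G b ≡ v₁ × tgt G b ≡ v₂
    × (∀ e → (e ∈ C) ⇔ (e ≡ a ⊎ e ≡ b)) )

Distinct : {k n : ℕ} → (Fin k → Fin n) → Set
Distinct vs = ∀ i j → vs i ≡ vs j → i ≡ j

-- C is the edge set of a coherently oriented cycle: either a loop, or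
-- distinct vertices v_0,…,v_{j+1} (length j+2 ≥ 2) with edges
-- (v_i, v_{i+1}) for i ≤ j and the closing edge (v_{j+1}, v_0).
CycleEdge : (G : Digraph) {j : ℕ} → (Fin (suc (suc j)) → Fin (n G)) → Fin (m G) → Set
CycleEdge G {j} vs e =
    (∃[ i ] (src G e ≡ vs (inject₁ i) × tgt G e ≡ vs (suc i)))
  ⊎ (src G e ≡ vs (fromℕ (suc j)) × tgt G e ≡ vs zero)

IsCoherentCycle : (G : Digraph) → Subset (m G) → Set
IsCoherentCycle G C =
    (∃[ a ] (src G a ≡ tgt G a × (∀ e → (e ∈ C) ⇔ (e ≡ a))))
  ⊎ (∃[ j ] Σ (Fin (suc (suc j)) → Fin (n G)) λ vs →
        Distinct vs
      × (∀ i → ∃[ e ] (src G e ≡ vs (inject₁ i) × tgt G e ≡ vs (suc i)))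
      × (∃[ e ] (src G e ≡ vs (fromℕ (suc j)) × tgt G e ≡ vs zero))
      × (∀ e → (e ∈ C) ⇔ CycleEdge G vs e))

{-# OPTIONS --safe #-}
module Submission where

-- Call a loop, a linear sink, a linear source or a coherently oriented cycle an obstruction.
-- A multipath S has an injective height function on vertices (the position in the
-- concatenated paths) that rises by one along every edge of S, so S contains no obstruction.
-- Conversely, an edge added to a multipath either joins the path ending at its source to the
-- path starting at its target, or creates an obstruction; adding the edges of S one at a time
-- shows that S is a multipath iff it contains no obstruction.
-- Finally no obstruction contains another one properly (in a coherent cycle every vertex has
-- a unique incoming edge, so a sub-cycle, being closed under predecessors, is everything),
-- and the circuits are exactly the edge sets of obstructions.

open import Defs
open import Data.Empty using (⊥-elim)
open import Data.Fin using (Fin; zero; suc; inject₁; fromℕ; toℕ)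
open import Data.Fin.Induction using (<-weakInduction; >-weakInduction)
open import Data.Fin.Properties
  using (toℕ-injective; toℕ-inject₁; inject₁-injective; fromℕ≢inject₁; any?)
  renaming (_≟_ to _≟ᶠ_)
open import Data.Fin.Subset using (Subset; _∈_; _⊂_; _-_)
open import Data.Fin.Subset.Properties using (_∈?_; x∈p⇒p-x⊂p; x∈p∧x≢y⇒x∈p-y)
open import Data.List
  using (List; []; _∷_; _++_; _∷ʳ_; [_]; concat; lookup; length; map; filter; allFin)
open import Data.List.Properties
  using (++-assoc; ∷-injectiveʳ; ∷ʳ-injectiveʳ; concat-map-[_])
import Data.List.Relation.Unary.All as All
open import Data.List.Relation.Unary.All.Properties using () renaming (++⁻ˡ to All-++⁻ˡ)
open import Data.List.Relation.Unary.AllPairs using ([]; _∷_)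
open import Data.List.Relation.Unary.Any as Any using (here; there)
open import Data.List.Relation.Unary.Any.Properties using (lookup-index)
open import Data.List.Relation.Unary.Unique.Propositional using (Unique)
open import Data.List.Relation.Unary.Unique.Propositional.Properties using (allFin⁺)
open import Data.List.Relation.Binary.Permutation.Propositional as ↭
  using (_↭_; ↭-refl; ↭-sym; ↭-trans; ↭⇒↭ₛ)
open import Data.List.Relation.Binary.Permutation.Propositional.Properties
  using (∈-resp-↭; ++⁺ˡ; shift; shifts)
import Data.List.Relation.Binary.Permutation.Setoid.Properties as PermutationSetoid
open import Data.List.Membership.Propositional
  using () renaming (_∈_ to _∈ˡ_; _∉_ to _∉ˡ_)
open import Data.List.Membership.Propositional.Properties
  using (∈-concat⁻′; ∈-∃++; ∈-lookup; ∈-filter⁻; ∈-filter⁺; ∈-allFin; ∈-map⁻)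
import Data.List.Membership.DecPropositional as DecMembership
open import Data.Nat using (ℕ; suc; _≤_; s≤s)
open import Data.Nat.Properties using (1+n≢n; 1+n≰n; m≤n⇒m≤1+n; ≤-refl; suc-injective)
open import Data.Product using (∃; ∃-syntax; ∃₂; _×_; _,_; proj₁; proj₂)
open import Data.Sum as Sum using (_⊎_; inj₁; inj₂)
open import Function.Bundles using (_⇔_; mk⇔; Equivalence)
open import Level using (0ℓ)
open import Relation.Binary.PropositionalEquality
  using (_≡_; _≢_; refl; sym; trans; cong; subst; subst₂; setoid; module ≡-Reasoning)
open import Relation.Nullary using (¬_; yes; no)
open import Relation.Nullary.Decidable using (_×-dec_; _⊎-dec_)
open import Relation.Unary using (Pred; _⊆_; Decidable)

module _ {A : Set} where

  data Adjacent : List A → A → A → Set where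
    here  : ∀ {v w l} → Adjacent (v ∷ w ∷ l) v w
    there : ∀ {a l v w} → Adjacent l v w → Adjacent (a ∷ l) v w

  adjacent-middle : ∀ xs {v w ys} → Adjacent (xs ++ v ∷ w ∷ ys) v w
  adjacent-middle []       = here
  adjacent-middle (_ ∷ xs) = there (adjacent-middle xs)

  consecutive⇒adjacent : ∀ {p v w} → Consecutive p v w → Adjacent p v w
  consecutive⇒adjacent (xs , _ , refl) = adjacent-middle xs

  adjacent⇒consecutive : ∀ {p v w} → Adjacent p v w → Consecutive p v w
  adjacent⇒consecutive here = [] , _ , refl
  adjacent⇒consecutive (there {a} adj) with xs , ys , refl ← adjacent⇒consecutive adj =
    a ∷ xs , ys , refl

  ¬adjacent-[_] : ∀ x {v w} → ¬ Adjacent [ x ] v w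
  ¬adjacent-[ _ ] (there ())

  adjacent-++⁺ˡ : ∀ {p} q {v w} → Adjacent p v w → Adjacent (p ++ q) v w
  adjacent-++⁺ˡ q here        = here
  adjacent-++⁺ˡ q (there adj) = there (adjacent-++⁺ˡ q adj)

  adjacent-++⁺ʳ : ∀ p {q v w} → Adjacent q v w → Adjacent (p ++ q) v w
  adjacent-++⁺ʳ []      adj = adj
  adjacent-++⁺ʳ (_ ∷ p) adj = there (adjacent-++⁺ʳ p adj)

  adjacent-concat⁺ : ∀ {ps p v w} → p ∈ˡ ps → Adjacent p v w → Adjacent (concat ps) v w
  adjacent-concat⁺ {_ ∷ ps} (here refl) adj = adjacent-++⁺ˡ (concat ps) adj
  adjacent-concat⁺ {q ∷ _}  (there p∈)  adj = adjacent-++⁺ʳ q (adjacent-concat⁺ p∈ adj)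

  adjacent-junction : ∀ xs {u w} ys → Adjacent ((xs ∷ʳ u) ++ w ∷ ys) u w
  adjacent-junction []       ys = here
  adjacent-junction (_ ∷ xs) ys = there (adjacent-junction xs ys)

  adjacent-junction⁻ : ∀ xs {u w} ys {v v′} → Adjacent ((xs ∷ʳ u) ++ w ∷ ys) v v′ →
                       Adjacent (xs ∷ʳ u) v v′ ⊎ Adjacent (w ∷ ys) v v′ ⊎ (v ≡ u × v′ ≡ w)
  adjacent-junction⁻ []           ys here        = inj₂ (inj₂ (refl , refl))
  adjacent-junction⁻ []           ys (there adj) = inj₂ (inj₁ adj)
  adjacent-junction⁻ (_ ∷ [])     ys here        = inj₁ here
  adjacent-junction⁻ (_ ∷ _ ∷ _)  ys here        = inj₁ here
  adjacent-junction⁻ (_ ∷ xs)     ys (there adj) = Sum.map₁ there (adjacent-junction⁻ xs ys adj)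

  ∈⇒last-or-adjacent : ∀ {v} {p : List A} → v ∈ˡ p →
                       (∃ λ xs → p ≡ xs ∷ʳ v) ⊎ (∃ λ w → Adjacent p v w)
  ∈⇒last-or-adjacent {p = _ ∷ []}    (here refl) = inj₁ ([] , refl)
  ∈⇒last-or-adjacent {p = _ ∷ w ∷ _} (here refl) = inj₂ (w , here)
  ∈⇒last-or-adjacent {p = x ∷ _}     (there v∈) with ∈⇒last-or-adjacent v∈
  ... | inj₁ (xs , refl) = inj₁ (x ∷ xs , refl)
  ... | inj₂ (w , adj)   = inj₂ (w , there adj)

  ∈⇒first-or-adjacent : ∀ {v} {p : List A} → v ∈ˡ p →
                        (∃ λ ys → p ≡ v ∷ ys) ⊎ (∃ λ u → Adjacent p u v)
  ∈⇒first-or-adjacent             (here refl) = inj₁ (_ , refl)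
  ∈⇒first-or-adjacent {p = x ∷ _} (there v∈) with ∈⇒first-or-adjacent v∈
  ... | inj₁ (_ , refl) = inj₂ (x , here)
  ... | inj₂ (u , adj)  = inj₂ (u , there adj)

  adjacent⇒lookup : ∀ {l v w} → Adjacent l v w →
                    ∃₂ λ i j → lookup l i ≡ v × lookup l j ≡ w × toℕ j ≡ suc (toℕ i)
  adjacent⇒lookup here = zero , suc zero , refl , refl , refl
  adjacent⇒lookup (there adj) with i , j , li , lj , j≡1+i ← adjacent⇒lookup adj =
    suc i , suc j , li , lj , cong suc j≡1+i

  lookup⇒adjacent : ∀ {x} l (i : Fin (length l)) →
                    Adjacent (x ∷ l) (lookup (x ∷ l) (inject₁ i)) (lookup (x ∷ l) (suc i))
  lookup⇒adjacent (_ ∷ _) zero    = here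
  lookup⇒adjacent (_ ∷ l) (suc i) = there (lookup⇒adjacent l i)

  lookup-last : ∀ y ys xs {u : A} → y ∷ ys ≡ xs ∷ʳ u →
                lookup (y ∷ ys) (fromℕ (length ys)) ≡ u
  lookup-last y []       xs       eq = ∷ʳ-injectiveʳ [] xs eq
  lookup-last y (z ∷ ys) []       ()
  lookup-last y (z ∷ ys) (x ∷ xs) eq = lookup-last z ys xs (∷-injectiveʳ eq)

  lookup-injective : ∀ {l : List A} → Unique l → ∀ {i j} → lookup l i ≡ lookup l j → i ≡ j
  lookup-injective {_ ∷ _} _           {zero}  {zero}  _  = refl
  lookup-injective         (x∉ ∷ _)    {zero}  {suc j} eq =
    ⊥-elim (All.lookup x∉ (∈-lookup j) eq)
  lookup-injective         (x∉ ∷ _)    {suc i} {zero}  eq =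
    ⊥-elim (All.lookup x∉ (∈-lookup i) (sym eq))
  lookup-injective         (_  ∷ uniq) {suc i} {suc j} eq = cong suc (lookup-injective uniq eq)

  Unique-++⁻ˡ : ∀ xs {ys : List A} → Unique (xs ++ ys) → Unique xs
  Unique-++⁻ˡ []       _          = []
  Unique-++⁻ˡ (_ ∷ xs) (x∉ ∷ uniq) = All-++⁻ˡ xs x∉ ∷ Unique-++⁻ˡ xs uniq

  Unique-resp-↭ : ∀ {xs ys : List A} → xs ↭ ys → Unique xs → Unique ys
  Unique-resp-↭ σ = PermutationSetoid.Unique-resp-↭ (setoid A) (↭⇒↭ₛ σ)

  concat-↭ : ∀ {xss yss : List (List A)} → xss ↭ yss → concat xss ↭ concat yss
  concat-↭ ↭.refl           = ↭-refl
  concat-↭ (↭.prep xs σ)    = ++⁺ˡ xs (concat-↭ σ)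
  concat-↭ (↭.swap xs ys σ) = ↭-trans (shifts xs ys) (++⁺ˡ ys (++⁺ˡ xs (concat-↭ σ)))
  concat-↭ (↭.trans σ τ)    = ↭-trans (concat-↭ σ) (concat-↭ τ)

∈⇒↭-front : ∀ {B : Set} {x : B} {xs} → x ∈ˡ xs → ∃ λ ys → xs ↭ x ∷ ys
∈⇒↭-front {x = x} x∈ with as , bs , refl ← ∈-∃++ x∈ = as ++ bs , shift x as bs

Pair : ∀ {B : Set} → B → B → Pred B 0ℓ
Pair a b x = x ≡ a ⊎ x ≡ b

Pair-⊆-distinct : ∀ {B : Set} {a b x y : B} →
                  Pair a b x → Pair a b y → x ≢ y → Pair a b ⊆ Pair x y
Pair-⊆-distinct (inj₁ refl) (inj₁ refl) x≢y _           = ⊥-elim (x≢y refl)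
Pair-⊆-distinct (inj₂ refl) (inj₂ refl) x≢y _           = ⊥-elim (x≢y refl)
Pair-⊆-distinct (inj₁ refl) (inj₂ refl) _   z∈          = z∈
Pair-⊆-distinct (inj₂ refl) (inj₁ refl) _   (inj₁ refl) = inj₂ refl
Pair-⊆-distinct (inj₂ refl) (inj₁ refl) _   (inj₂ refl) = inj₁ refl

previous : ∀ {k} → Fin (suc k) → Fin (suc k)
previous {k} zero = fromℕ k
previous (suc i) = inject₁ i

previous-injective : ∀ {k} {s t : Fin (suc k)} → previous s ≡ previous t → s ≡ t
previous-injective {s = zero}  {zero}  _  = refl
previous-injective {s = zero}  {suc t} eq = ⊥-elim (fromℕ≢inject₁ eq)
previous-injective {s = suc s} {zero}  eq = ⊥-elim (fromℕ≢inject₁ (sym eq))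
previous-injective {s = suc s} {suc t} eq = cong suc (inject₁-injective eq)

previous-≢ : ∀ {k} (t : Fin (suc (suc k))) → previous t ≢ t
previous-≢ zero    ()
previous-≢ (suc i) eq = 1+n≢n (sym (trans (sym (toℕ-inject₁ i)) (cong toℕ eq)))

descend-to-zero : ∀ {k} (P : Pred (Fin (suc k)) 0ℓ) →
                  (∀ i → P (suc i) → P (inject₁ i)) → ∀ t → P t → P zero
descend-to-zero         P down zero    pt = pt
descend-to-zero {suc k} P down (suc i) pt =
  descend-to-zero (λ t → P (inject₁ t)) (λ j → down (inject₁ j)) i (down i pt)

previous-closed⇒universal : ∀ {k} (P : Pred (Fin (suc k)) 0ℓ) →
                            (∀ t → P t → P (previous t)) → ∀ t → P t → ∀ s → P s
previous-closed⇒universal P closed t pt =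
  >-weakInduction P (closed zero (descend-to-zero P down t pt)) down
  where
  down : ∀ i → P (suc i) → P (inject₁ i)
  down i = closed (suc i)

module Multipaths (G : Digraph) where

  V : Set
  V = Fin (n G)

  E : Set
  E = Fin (m G)

  record Cycle : Set where
    field
      len      : ℕ
      vertex   : Fin (suc (suc len)) → V
      distinct : Distinct vertex
      step     : ∀ i → ∃[ e ] (src G e ≡ vertex (inject₁ i) × tgt G e ≡ vertex (suc i))
      closing  : ∃[ e ] (src G e ≡ vertex (fromℕ (suc len)) × tgt G e ≡ vertex zero)

    Edge : Pred E 0ℓ
    Edge = CycleEdge G vertex

    Enters : E → Fin (suc (suc len)) → Set
    Enters e t = src G e ≡ vertex (previous t) × tgt G e ≡ vertex t

    edge⇒enters : ∀ {e} → Edge e → ∃ (Enters e)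
    edge⇒enters (inj₁ (i , s , t)) = suc i , s , t
    edge⇒enters (inj₂ (s , t))     = zero , s , t

    enters⇒edge : ∀ {e t} → Enters e t → Edge e
    enters⇒edge {t = zero}  (s , t′) = inj₂ (s , t′)
    enters⇒edge {t = suc i} (s , t′) = inj₁ (i , s , t′)

    entering : ∀ t → ∃[ e ] Enters e t
    entering zero    = closing
    entering (suc i) = step i

    some-edge : ∃ Edge
    some-edge with e , enters-e ← entering zero = e , enters⇒edge enters-e

    enters-unique : ∀ {e f t} → Enters e t → Enters f t → e ≡ f
    enters-unique (se , te) (sf , tf) = simple G _ _ (trans se (sym sf)) (trans te (sym tf))

    enters-distinct : ∀ {e f t u} → Enters e t → Enters f u → t ≢ u →
                      src G e ≢ src G f × tgt G e ≢ tgt G f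
    enters-distinct {t = t} {u} (se , te) (sf , tf) t≢u =
      (λ eq → t≢u (previous-injective {s = t} {u} (distinct _ _ (trans (sym se) (trans eq sf))))) ,
      (λ eq → t≢u (distinct t u (trans (sym te) (trans eq tf))))

    edge-into : ∀ {e t} → Edge e → tgt G e ≡ vertex t → Enters e t
    edge-into {t = t} e∈ te with u , su , tu ← edge⇒enters e∈
      with refl ← distinct u t (trans (sym tu) te) = su , tu

    edge-from : ∀ {e t} → Edge e → src G e ≡ vertex (previous t) → Enters e t
    edge-from {t = t} e∈ se with u , su , tu ← edge⇒enters e∈
      with refl ← previous-injective {s = u} {t} (distinct _ _ (trans (sym su) se)) =
      su , tu

    edge-nonloop : ∀ {e} → Edge e → src G e ≢ tgt G e
    edge-nonloop e∈ eq with t , s , t′ ← edge⇒enters e∈ =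
      previous-≢ t (distinct _ _ (trans (sym s) (trans eq t′)))

    target-injective : ∀ {e f} → Edge e → Edge f → tgt G e ≡ tgt G f → e ≡ f
    target-injective e∈ f∈ eq with t , se , te ← edge⇒enters e∈ =
      enters-unique (se , te) (edge-into f∈ (trans (sym eq) te))

    source-injective : ∀ {e f} → Edge e → Edge f → src G e ≡ src G f → e ≡ f
    source-injective e∈ f∈ eq with t , se , te ← edge⇒enters e∈ =
      enters-unique (se , te) (edge-from f∈ (trans (sym eq) se))

    two-edges : ∃₂ λ e f → Edge e × Edge f × src G e ≢ src G f × tgt G e ≢ tgt G f
    two-edges with e , enters-e ← entering zero | f , enters-f ← entering (suc zero) =
      e , f , enters⇒edge enters-e , enters⇒edge enters-f , enters-distinct enters-e enters-f λ ()

    predecessor-closed⇒⊇ : (Q : Pred E 0ℓ) → Q ⊆ Edge →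
      (∀ {f} → Q f → ∃[ g ] (Q g × tgt G g ≡ src G f)) → ∃ Q → Edge ⊆ Q
    predecessor-closed⇒⊇ Q Q⊆Edge predecessor (f₀ , Qf₀) e∈
      with t , enters-e ← edge⇒enters e∈ = subst Q (sym (is-incoming enters-e)) (all-incoming t)
      where
      incoming : Fin (suc (suc len)) → E
      incoming t = proj₁ (entering t)
      is-incoming : ∀ {e t} → Enters e t → e ≡ incoming t
      is-incoming {t = t} enters-e = enters-unique enters-e (proj₂ (entering t))
      R : Pred (Fin (suc (suc len))) 0ℓ
      R t = Q (incoming t)
      closed : ∀ t → R t → R (previous t)
      closed t Rt with g , Qg , tg ← predecessor Rt =
        subst Q (is-incoming (edge-into (Q⊆Edge Qg) (trans tg (proj₁ (proj₂ (entering t)))))) Qg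
      all-incoming : ∀ t → R t
      all-incoming with t₀ , enters-f₀ ← edge⇒enters (Q⊆Edge Qf₀) =
        previous-closed⇒universal R closed t₀ (subst Q (is-incoming enters-f₀) Qf₀)

  sub-cycle⇒⊇ : (c w : Cycle) → Cycle.Edge w ⊆ Cycle.Edge c → Cycle.Edge c ⊆ Cycle.Edge w
  sub-cycle⇒⊇ c w w⊆c = Cycle.predecessor-closed⇒⊇ c Edge w⊆c predecessor some-edge
    where
    open Cycle w
    predecessor : ∀ {f} → Edge f → ∃[ g ] (Edge g × tgt G g ≡ src G f)
    predecessor f∈ with t , sf , _ ← edge⇒enters f∈
      with g , sg , tg ← entering (previous t) =
      g , enters⇒edge (sg , tg) , trans tg (sym sf)

  data Obstruction : Set where
    loop   : (a : E) → src G a ≡ tgt G a → Obstruction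
    sink   : (a b : E) → src G a ≢ tgt G a → src G b ≢ tgt G b →
             src G a ≢ src G b → tgt G a ≡ tgt G b → Obstruction
    source : (a b : E) → src G a ≢ tgt G a → src G b ≢ tgt G b →
             tgt G a ≢ tgt G b → src G a ≡ src G b → Obstruction
    cycle  : Cycle → Obstruction

  edges : Obstruction → Pred E 0ℓ
  edges (loop a _)           = _≡ a
  edges (sink a b _ _ _ _)   = Pair a b
  edges (source a b _ _ _ _) = Pair a b
  edges (cycle c)            = Cycle.Edge c

  edges? : ∀ O → Decidable (edges O)
  edges? (loop a _)           e = e ≟ᶠ a
  edges? (sink a b _ _ _ _)   e = (e ≟ᶠ a) ⊎-dec (e ≟ᶠ b)
  edges? (source a b _ _ _ _) e = (e ≟ᶠ a) ⊎-dec (e ≟ᶠ b)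
  edges? (cycle c)            e =
    any? (λ i → (src G e ≟ᶠ vertex (inject₁ i)) ×-dec (tgt G e ≟ᶠ vertex (suc i)))
    ⊎-dec ((src G e ≟ᶠ vertex (fromℕ (suc len))) ×-dec (tgt G e ≟ᶠ vertex zero))
    where open Cycle c

  ObstructionIn : Pred E 0ℓ → Set
  ObstructionIn P = ∃[ O ] (edges O ⊆ P)

  nonempty : ∀ O → ∃ (edges O)
  nonempty (loop a _)           = a , refl
  nonempty (sink a _ _ _ _ _)   = a , inj₁ refl
  nonempty (source a _ _ _ _ _) = a , inj₁ refl
  nonempty (cycle c)            = Cycle.some-edge c

  Pair-nonloop : ∀ {a b e} → src G a ≢ tgt G a → src G b ≢ tgt G b →
                 Pair a b e → src G e ≢ tgt G e
  Pair-nonloop a↺ _  (inj₁ refl) = a↺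
  Pair-nonloop _  b↺ (inj₂ refl) = b↺

  Pair-constant : ∀ (h : E → V) {a b x y} → h a ≡ h b → Pair a b x → Pair a b y → h x ≡ h y
  Pair-constant h eq (inj₁ refl) (inj₁ refl) = refl
  Pair-constant h eq (inj₁ refl) (inj₂ refl) = eq
  Pair-constant h eq (inj₂ refl) (inj₁ refl) = sym eq
  Pair-constant h eq (inj₂ refl) (inj₂ refl) = refl

  obstruction-minimal : ∀ O O′ → edges O′ ⊆ edges O → edges O ⊆ edges O′
  obstruction-minimal (loop a _) O′ O′⊆O refl with f , f∈O′ ← nonempty O′ =
    subst (edges O′) (O′⊆O f∈O′) f∈O′
  obstruction-minimal (sink a b a↺ b↺ _ _) (loop a′ ℓ) O′⊆O _ =
    ⊥-elim (Pair-nonloop a↺ b↺ (O′⊆O refl) ℓ)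
  obstruction-minimal (sink a b _ _ _ _) (sink a′ b′ _ _ ns _) O′⊆O =
    Pair-⊆-distinct (O′⊆O (inj₁ refl)) (O′⊆O (inj₂ refl)) (λ eq → ns (cong (src G) eq))
  obstruction-minimal (sink a b _ _ _ tt) (source a′ b′ _ _ nt _) O′⊆O _ =
    ⊥-elim (nt (Pair-constant (tgt G) tt (O′⊆O (inj₁ refl)) (O′⊆O (inj₂ refl))))
  obstruction-minimal (sink a b _ _ _ tt) (cycle w) O′⊆O _
    with e , f , e∈ , f∈ , _ , nt ← Cycle.two-edges w =
    ⊥-elim (nt (Pair-constant (tgt G) tt (O′⊆O e∈) (O′⊆O f∈)))
  obstruction-minimal (source a b a↺ b↺ _ _) (loop a′ ℓ) O′⊆O _ =
    ⊥-elim (Pair-nonloop a↺ b↺ (O′⊆O refl) ℓ)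
  obstruction-minimal (source a b _ _ _ ss) (sink a′ b′ _ _ ns _) O′⊆O _ =
    ⊥-elim (ns (Pair-constant (src G) ss (O′⊆O (inj₁ refl)) (O′⊆O (inj₂ refl))))
  obstruction-minimal (source a b _ _ _ _) (source a′ b′ _ _ nt _) O′⊆O =
    Pair-⊆-distinct (O′⊆O (inj₁ refl)) (O′⊆O (inj₂ refl)) (λ eq → nt (cong (tgt G) eq))
  obstruction-minimal (source a b _ _ _ ss) (cycle w) O′⊆O _
    with e , f , e∈ , f∈ , ns , _ ← Cycle.two-edges w =
    ⊥-elim (ns (Pair-constant (src G) ss (O′⊆O e∈) (O′⊆O f∈)))
  obstruction-minimal (cycle c) (loop a′ ℓ) O′⊆O _ =
    ⊥-elim (Cycle.edge-nonloop c (O′⊆O refl) ℓ)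
  obstruction-minimal (cycle c) (sink a′ b′ _ _ ns tt) O′⊆O _ =
    ⊥-elim (ns (cong (src G)
      (Cycle.target-injective c (O′⊆O (inj₁ refl)) (O′⊆O (inj₂ refl)) tt)))
  obstruction-minimal (cycle c) (source a′ b′ _ _ nt ss) O′⊆O _ =
    ⊥-elim (nt (cong (tgt G)
      (Cycle.source-injective c (O′⊆O (inj₁ refl)) (O′⊆O (inj₂ refl)) ss)))
  obstruction-minimal (cycle c) (cycle w) O′⊆O = sub-cycle⇒⊇ c w O′⊆O

  record Grading (P : Pred E 0ℓ) : Set where
    field
      height           : V → ℕ
      height-injective : ∀ {v w} → height v ≡ height w → v ≡ w
      ascends          : ∀ {e} → P e → height (tgt G e) ≡ suc (height (src G e))

    ascends-along : ∀ {e v w} → P e → src G e ≡ v → tgt G e ≡ w → height w ≡ suc (height v)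
    ascends-along pe refl refl = ascends pe

    loop-free : ∀ {e} → P e → src G e ≢ tgt G e
    loop-free pe eq = 1+n≢n (trans (sym (ascends pe)) (cong height (sym eq)))

    same-target⇒same-source : ∀ {a b} → P a → P b → tgt G a ≡ tgt G b → src G a ≡ src G b
    same-target⇒same-source pa pb eq =
      height-injective (suc-injective
        (trans (sym (ascends pa)) (trans (cong height eq) (ascends pb))))

    same-source⇒same-target : ∀ {a b} → P a → P b → src G a ≡ src G b → tgt G a ≡ tgt G b
    same-source⇒same-target pa pb eq =
      height-injective
        (trans (ascends pa) (trans (cong (λ v → suc (height v)) eq) (sym (ascends pb))))

    acyclic : ∀ c → ¬ (Cycle.Edge c ⊆ P)
    acyclic c c⊆P = 1+n≰n (subst (suc (height (vertex zero)) ≤_) (sym (climbs zero))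
                                 (s≤s (above-start (fromℕ (suc len)))))
      where
      open Cycle c
      climbs : ∀ t → height (vertex t) ≡ suc (height (vertex (previous t)))
      climbs t with e , s , t′ ← entering t = ascends-along (c⊆P (enters⇒edge (s , t′))) s t′
      above-start : ∀ t → height (vertex zero) ≤ height (vertex t)
      above-start = <-weakInduction _ ≤-refl λ i h →
        subst (height (vertex zero) ≤_) (sym (climbs (suc i))) (m≤n⇒m≤1+n h)

    no-obstruction : ¬ ObstructionIn P
    no-obstruction (loop a ℓ , O⊆P) = loop-free (O⊆P refl) ℓ
    no-obstruction (sink a b _ _ ns tt , O⊆P) =
      ns (same-target⇒same-source (O⊆P (inj₁ refl)) (O⊆P (inj₂ refl)) tt)
    no-obstruction (source a b _ _ nt ss , O⊆P) =
      nt (same-source⇒same-target (O⊆P (inj₁ refl)) (O⊆P (inj₂ refl)) ss)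
    no-obstruction (cycle c , O⊆P) = acyclic c O⊆P

  record PathCover (P : Pred E 0ℓ) (ps : List (List V)) : Set where
    field
      unique             : Unique (concat ps)
      covers             : ∀ v → v ∈ˡ concat ps
      adjacency-realised : ∀ {p v w} → p ∈ˡ ps → Adjacent p v w →
                           ∃[ e ] (src G e ≡ v × tgt G e ≡ w)
      edge⇒adjacent      : ∀ {e} → P e → ∃[ p ] (p ∈ˡ ps × Adjacent p (src G e) (tgt G e))
      adjacent⇒edge      : ∀ {p e} → p ∈ˡ ps → Adjacent p (src G e) (tgt G e) → P e

    adjacent⇒edgeIn : ∀ {p v w} → p ∈ˡ ps → Adjacent p v w →
                      ∃[ e ] (P e × src G e ≡ v × tgt G e ≡ w)
    adjacent⇒edgeIn p∈ adj with e , refl , refl ← adjacency-realised p∈ adj =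
      e , adjacent⇒edge p∈ adj , refl , refl

    grading : Grading P
    grading = record
      { height           = position
      ; height-injective = λ eq → trans (sym (at-position _))
                             (trans (cong (lookup (concat ps)) (toℕ-injective eq)) (at-position _))
      ; ascends          = ascends
      }
      where
      position : V → ℕ
      position v = toℕ (Any.index (covers v))
      at-position : ∀ v → lookup (concat ps) (Any.index (covers v)) ≡ v
      at-position v = sym (lookup-index (covers v))
      ascends : ∀ {e} → P e → position (tgt G e) ≡ suc (position (src G e))
      ascends pe with p , p∈ , adj ← edge⇒adjacent pe
        with i , j , li , lj , j≡1+i ← adjacent⇒lookup (adjacent-concat⁺ p∈ adj) = begin
          position (tgt G _)       ≡⟨ cong toℕ (lookup-injective unique (trans (at-position _) (sym lj))) ⟩
          toℕ j                    ≡⟨ j≡1+i ⟩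
          suc (toℕ i)              ≡⟨ cong (λ k → suc (toℕ k))
                                        (lookup-injective unique (trans li (sym (at-position _)))) ⟩
          suc (position (src G _)) ∎
        where open ≡-Reasoning

    successor-or-last : ∀ v → (∃₂ λ w p → p ∈ˡ ps × Adjacent p v w) ⊎ (∃ λ xs → (xs ∷ʳ v) ∈ˡ ps)
    successor-or-last v with p , v∈p , p∈ ← ∈-concat⁻′ ps (covers v)
      with ∈⇒last-or-adjacent v∈p
    ... | inj₁ (xs , refl) = inj₂ (xs , p∈)
    ... | inj₂ (w , adj)   = inj₁ (w , p , p∈ , adj)

    predecessor-or-first : ∀ v → (∃₂ λ u p → p ∈ˡ ps × Adjacent p u v) ⊎ (∃ λ ys → (v ∷ ys) ∈ˡ ps)
    predecessor-or-first v with p , v∈p , p∈ ← ∈-concat⁻′ ps (covers v)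
      with ∈⇒first-or-adjacent v∈p
    ... | inj₁ (ys , refl) = inj₂ (ys , p∈)
    ... | inj₂ (u , adj)   = inj₁ (u , p , p∈ , adj)

  open PathCover

  pathCover⇒isMultipath : ∀ {S ps} → PathCover (_∈ S) ps → IsMultipath G S
  pathCover⇒isMultipath {ps = ps} cover =
    ps , unique cover , covers cover ,
    (λ p p∈ v w c → adjacency-realised cover p∈ (consecutive⇒adjacent c)) ,
    λ e → mk⇔ (λ e∈ → let p , p∈ , adj = edge⇒adjacent cover e∈ in
                        p , p∈ , adjacent⇒consecutive adj)
              (λ (p , p∈ , c) → adjacent⇒edge cover p∈ (consecutive⇒adjacent c))

  isMultipath⇒pathCover : ∀ {S} → IsMultipath G S → ∃ (PathCover (_∈ S))
  isMultipath⇒pathCover (ps , uniq , cov , arcs , S⇔) = ps , record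
    { unique             = uniq
    ; covers             = cov
    ; adjacency-realised = λ p∈ adj → arcs _ p∈ _ _ (adjacent⇒consecutive adj)
    ; edge⇒adjacent      = λ {e} e∈ → let p , p∈ , c = Equivalence.to (S⇔ e) e∈ in
                                       p , p∈ , consecutive⇒adjacent c
    ; adjacent⇒edge      = λ {_} {e} p∈ adj →
                             Equivalence.from (S⇔ e) (_ , p∈ , adjacent⇒consecutive adj)
    }

  PathCover-resp : ∀ {P Q ps} → P ⊆ Q → Q ⊆ P → PathCover P ps → PathCover Q ps
  PathCover-resp P⊆Q Q⊆P cover = record
    { unique             = unique cover
    ; covers             = covers cover
    ; adjacency-realised = adjacency-realised cover
    ; edge⇒adjacent      = λ qe → edge⇒adjacent cover (Q⊆P qe)
    ; adjacent⇒edge      = λ p∈ adj → P⊆Q (adjacent⇒edge cover p∈ adj)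
    }

  PathCover-↭ : ∀ {P ps qs} → ps ↭ qs → PathCover P ps → PathCover P qs
  PathCover-↭ σ cover = record
    { unique             = Unique-resp-↭ (concat-↭ σ) (unique cover)
    ; covers             = λ v → ∈-resp-↭ (concat-↭ σ) (covers cover v)
    ; adjacency-realised = λ p∈ → adjacency-realised cover (∈-resp-↭ (↭-sym σ) p∈)
    ; edge⇒adjacent      = λ pe → let p , p∈ , adj = edge⇒adjacent cover pe in
                                   p , ∈-resp-↭ σ p∈ , adj
    ; adjacent⇒edge      = λ p∈ → adjacent⇒edge cover (∈-resp-↭ (↭-sym σ) p∈)
    }

  trivial-cover : PathCover (_∈ˡ []) (map [_] (allFin (n G)))
  trivial-cover = record
    { unique             = subst Unique (sym (concat-map-[ allFin _ ])) (allFin⁺ _)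
    ; covers             = λ v → subst (v ∈ˡ_) (sym (concat-map-[ allFin _ ])) (∈-allFin v)
    ; adjacency-realised = λ p∈ adj → ⊥-elim (singleton-path p∈ adj)
    ; edge⇒adjacent      = λ ()
    ; adjacent⇒edge      = λ p∈ adj → ⊥-elim (singleton-path p∈ adj)
    }
    where
    singleton-path : ∀ {p v w} → p ∈ˡ map [_] (allFin (n G)) → ¬ Adjacent p v w
    singleton-path p∈ with x , _ , refl ← ∈-map⁻ [_] p∈ = ¬adjacent-[ x ]

  join : ∀ {es e xs ys ps} → PathCover (_∈ˡ es) ((xs ∷ʳ src G e) ∷ (tgt G e ∷ ys) ∷ ps) →
         PathCover (_∈ˡ e ∷ es) (((xs ∷ʳ src G e) ++ tgt G e ∷ ys) ∷ ps)
  join {es} {e} {xs} {ys} {ps} cover = record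
    { unique             = subst Unique (sym reassociate) (unique cover)
    ; covers             = λ v → subst (v ∈ˡ_) (sym reassociate) (covers cover v)
    ; adjacency-realised = arc
    ; edge⇒adjacent      = adjacent
    ; adjacent⇒edge      = edge
    }
    where
    p q : List V
    p = xs ∷ʳ src G e
    q = tgt G e ∷ ys
    reassociate : concat ((p ++ q) ∷ ps) ≡ concat (p ∷ q ∷ ps)
    reassociate = ++-assoc p q (concat ps)
    arc : ∀ {r v w} → r ∈ˡ (p ++ q) ∷ ps → Adjacent r v w →
          ∃[ f ] (src G f ≡ v × tgt G f ≡ w)
    arc (here refl) adj with adjacent-junction⁻ xs ys adj
    ... | inj₁ adj′                 = adjacency-realised cover (here refl) adj′
    ... | inj₂ (inj₁ adj′)          = adjacency-realised cover (there (here refl)) adj′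
    ... | inj₂ (inj₂ (refl , refl)) = e , refl , refl
    arc (there r∈) adj = adjacency-realised cover (there (there r∈)) adj
    adjacent : ∀ {f} → f ∈ˡ e ∷ es →
               ∃[ r ] (r ∈ˡ (p ++ q) ∷ ps × Adjacent r (src G f) (tgt G f))
    adjacent (here refl) = p ++ q , here refl , adjacent-junction xs ys
    adjacent (there f∈) with edge⇒adjacent cover f∈
    ... | _ , here refl , adj         = p ++ q , here refl , adjacent-++⁺ˡ q adj
    ... | _ , there (here refl) , adj = p ++ q , here refl , adjacent-++⁺ʳ p adj
    ... | r , there (there r∈) , adj  = r , there r∈ , adj
    edge : ∀ {r f} → r ∈ˡ (p ++ q) ∷ ps → Adjacent r (src G f) (tgt G f) → f ∈ˡ e ∷ es
    edge {f = f} (here refl) adj with adjacent-junction⁻ xs ys adj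
    ... | inj₁ adj′           = there (adjacent⇒edge cover (here refl) adj′)
    ... | inj₂ (inj₁ adj′)    = there (adjacent⇒edge cover (there (here refl)) adj′)
    ... | inj₂ (inj₂ (s , t)) = here (simple G f e s t)
    edge (there r∈) adj = there (adjacent⇒edge cover (there (there r∈)) adj)

  closing-cycle : ∀ {es e xs ys ps} → PathCover (_∈ˡ es) ((tgt G e ∷ ys) ∷ ps) →
                  tgt G e ∷ ys ≡ xs ∷ʳ src G e → src G e ≢ tgt G e → ObstructionIn (_∈ˡ e ∷ es)
  closing-cycle {xs = xs} {ys = []} _ eq nonloop =
    ⊥-elim (nonloop (sym (∷ʳ-injectiveʳ [] xs eq)))
  closing-cycle {es} {e} {xs} {ys = b ∷ t} cover eq _ = cycle c , in-es
    where
    path : List V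
    path = tgt G e ∷ b ∷ t
    last≡ : lookup path (fromℕ (suc (length t))) ≡ src G e
    last≡ = lookup-last (tgt G e) (b ∷ t) xs eq
    c : Cycle
    c = record
      { len      = length t
      ; vertex   = lookup path
      ; distinct = λ i j → lookup-injective (Unique-++⁻ˡ path (unique cover))
      ; step     = λ i → adjacency-realised cover (here refl) (lookup⇒adjacent (b ∷ t) i)
      ; closing  = e , sym last≡ , refl
      }
    in-es : Cycle.Edge c ⊆ (_∈ˡ e ∷ es)
    in-es (inj₁ (i , s , t′)) = there (adjacent⇒edge cover (here refl)
      (subst₂ (Adjacent path) (sym s) (sym t′) (lookup⇒adjacent (b ∷ t) i)))
    in-es {f} (inj₂ (s , t′)) = here (simple G f e (trans s last≡) t′)

  module Extension {es ps e} (cover : PathCover (_∈ˡ es) ps)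
                   (e∉es : e ∉ˡ es) (nonloop : src G e ≢ tgt G e) where

    open Grading (grading cover)

    branching : ∀ {f} → f ∈ˡ es → src G f ≡ src G e → ObstructionIn (_∈ˡ e ∷ es)
    branching {f} f∈ sf = source e f nonloop (loop-free f∈) different-targets (sym sf) , λ where
        (inj₁ refl) → here refl
        (inj₂ refl) → there f∈
      where
      different-targets : tgt G e ≢ tgt G f
      different-targets eq = e∉es (subst (_∈ˡ es) (sym (simple G e f (sym sf) eq)) f∈)

    merging : ∀ {f} → f ∈ˡ es → tgt G f ≡ tgt G e → ObstructionIn (_∈ˡ e ∷ es)
    merging {f} f∈ tf = sink e f nonloop (loop-free f∈) different-sources (sym tf) , λ where
        (inj₁ refl) → here refl
        (inj₂ refl) → there f∈
      where
      different-sources : src G e ≢ src G f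
      different-sources eq = e∉es (subst (_∈ˡ es) (sym (simple G e f eq (sym tf))) f∈)

    connect : ∀ {xs ys} → (xs ∷ʳ src G e) ∈ˡ ps → (tgt G e ∷ ys) ∈ˡ ps →
              ∃ (PathCover (_∈ˡ e ∷ es)) ⊎ ObstructionIn (_∈ˡ e ∷ es)
    connect {ys = ys} p∈ q∈ with ps₁ , σ ← ∈⇒↭-front p∈ with ∈-resp-↭ σ q∈
    ... | there q∈ps₁ with ps₂ , τ ← ∈⇒↭-front q∈ps₁ =
      inj₁ (_ , join (PathCover-↭ (↭-trans σ (↭.prep _ τ)) cover))
    ... | here q≡p = inj₂ (closing-cycle cover′ q≡p nonloop)
      where
      cover′ : PathCover (_∈ˡ es) ((tgt G e ∷ ys) ∷ ps₁)
      cover′ = subst (λ r → PathCover (_∈ˡ es) (r ∷ ps₁)) (sym q≡p) (PathCover-↭ σ cover)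

    extend : ∃ (PathCover (_∈ˡ e ∷ es)) ⊎ ObstructionIn (_∈ˡ e ∷ es)
    extend with successor-or-last cover (src G e) | predecessor-or-first cover (tgt G e)
    ... | inj₁ (_ , _ , p∈ , adj) | _
      with f , f∈ , sf , _ ← adjacent⇒edgeIn cover p∈ adj = inj₂ (branching f∈ sf)
    ... | inj₂ _ | inj₁ (_ , _ , q∈ , adj)
      with f , f∈ , _ , tf ← adjacent⇒edgeIn cover q∈ adj = inj₂ (merging f∈ tf)
    ... | inj₂ (_ , p∈) | inj₂ (_ , q∈) = connect p∈ q∈

  open DecMembership (_≟ᶠ_ {m G}) using () renaming (_∈?_ to _∈ˡ?_)

  multipath-or-obstructionˡ : ∀ es → ∃ (PathCover (_∈ˡ es)) ⊎ ObstructionIn (_∈ˡ es)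
  multipath-or-obstructionˡ [] = inj₁ (_ , trivial-cover)
  multipath-or-obstructionˡ (e ∷ es) with multipath-or-obstructionˡ es
  ... | inj₂ (O , O⊆es) = inj₂ (O , λ f∈ → there (O⊆es f∈))
  ... | inj₁ (ps , cover) with src G e ≟ᶠ tgt G e | e ∈ˡ? es
  ...   | yes ℓ  | _       = inj₂ (loop e ℓ , here)
  ...   | no _   | yes e∈  =
    inj₁ (ps , PathCover-resp there (λ { (here refl) → e∈ ; (there f∈) → f∈ }) cover)
  ...   | no ¬ℓ  | no e∉   = Extension.extend cover e∉ ¬ℓ

  listing : Subset (m G) → List E
  listing S = filter (_∈? S) (allFin (m G))

  listed⇒∈ : ∀ {S e} → e ∈ˡ listing S → e ∈ S
  listed⇒∈ {S} e∈ = proj₂ (∈-filter⁻ (_∈? S) {xs = allFin (m G)} e∈)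

  ∈⇒listed : ∀ {S e} → e ∈ S → e ∈ˡ listing S
  ∈⇒listed {S} {e} e∈ = ∈-filter⁺ (_∈? S) (∈-allFin e) e∈

  multipath-or-obstruction : ∀ S → IsMultipath G S ⊎ ObstructionIn (_∈ S)
  multipath-or-obstruction S with multipath-or-obstructionˡ (listing S)
  ... | inj₁ (_ , cover) =
    inj₁ (pathCover⇒isMultipath (PathCover-resp listed⇒∈ ∈⇒listed cover))
  ... | inj₂ (O , O⊆)   = inj₂ (O , λ e∈O → listed⇒∈ (O⊆ e∈O))

  obstruction⇒¬multipath : ∀ {S} → ObstructionIn (_∈ S) → ¬ IsMultipath G S
  obstruction⇒¬multipath O mp with _ , cover ← isMultipath⇒pathCover mp =
    Grading.no-obstruction (grading cover) O

  Shape : Subset (m G) → Set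
  Shape C = IsLinearSink G C ⊎ IsLinearSource G C ⊎ IsCoherentCycle G C

  EdgeSetOf : Obstruction → Subset (m G) → Set
  EdgeSetOf O C = ∀ e → (e ∈ C) ⇔ edges O e

  shape⇒obstruction : ∀ {C} → Shape C → ∃[ O ] EdgeSetOf O C
  shape⇒obstruction
    (inj₁ (_ , _ , _ , a , b , v₀≢v₁ , v₁≢v₂ , v₀≢v₂ , refl , refl , refl , tb , C≐)) =
    sink a b v₀≢v₁ (λ ℓ → v₁≢v₂ (trans (sym tb) (sym ℓ))) v₀≢v₂ (sym tb) , C≐
  shape⇒obstruction
    (inj₂ (inj₁ (_ , _ , _ , a , b , v₀≢v₁ , v₁≢v₂ , v₀≢v₂ , refl , refl , sb , refl , C≐))) =
    source a b (λ ℓ → v₀≢v₁ (sym ℓ)) (λ ℓ → v₁≢v₂ (trans (sym sb) ℓ)) v₀≢v₂ (sym sb) , C≐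
  shape⇒obstruction (inj₂ (inj₂ (inj₁ (a , ℓ , C≐)))) = loop a ℓ , C≐
  shape⇒obstruction (inj₂ (inj₂ (inj₂ (j , vs , d , st , cl , C≐)))) =
    cycle (record { len = j ; vertex = vs ; distinct = d ; step = st ; closing = cl }) , C≐

  obstruction⇒shape : ∀ {C} O → EdgeSetOf O C → Shape C
  obstruction⇒shape (loop a ℓ) C≐ = inj₂ (inj₂ (inj₁ (a , ℓ , C≐)))
  obstruction⇒shape (sink a b a↺ b↺ ns tt) C≐ =
    inj₁ (src G a , tgt G a , src G b , a , b , a↺ , (λ eq → b↺ (trans (sym eq) tt)) , ns ,
          refl , refl , refl , sym tt , C≐)
  obstruction⇒shape (source a b a↺ b↺ nt ss) C≐ =
    inj₂ (inj₁ (tgt G a , src G a , tgt G b , a , b ,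
                (λ eq → a↺ (sym eq)) , (λ eq → b↺ (trans (sym ss) eq)) , nt ,
                refl , refl , sym ss , refl , C≐))
  obstruction⇒shape (cycle c) C≐ =
    inj₂ (inj₂ (inj₂ (len , vertex , distinct , step , closing , C≐)))
    where open Cycle c

  circuit⇒shape : ∀ {C} → IsCircuit (IsMultipath G) C → Shape C
  circuit⇒shape {C} (dependent , proper⇒independent) with multipath-or-obstruction C
  ... | inj₁ mp        = ⊥-elim (dependent mp)
  ... | inj₂ (O , O⊆C) = obstruction⇒shape O (λ _ → mk⇔ C⊆O O⊆C)
    where
    C⊆O : ∀ {e} → e ∈ C → edges O e
    C⊆O {e} e∈C with edges? O e
    ... | yes e∈O = e∈O
    ... | no  e∉O =
      ⊥-elim (obstruction⇒¬multipath (O , O⊆C-e) (proper⇒independent (C - e) (x∈p⇒p-x⊂p e∈C)))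
      where
      O⊆C-e : edges O ⊆ (_∈ C - e)
      O⊆C-e f∈O = x∈p∧x≢y⇒x∈p-y (O⊆C f∈O) (λ { refl → e∉O f∈O })

  shape⇒circuit : ∀ {C} → Shape C → IsCircuit (IsMultipath G) C
  shape⇒circuit {C} shape with O , C≐O ← shape⇒obstruction shape =
    obstruction⇒¬multipath (O , λ {e} → Equivalence.from (C≐O e)) , proper⇒multipath
    where
    proper⇒multipath : ∀ D → D ⊂ C → IsMultipath G D
    proper⇒multipath D (D⊆C , x , x∈C , x∉D) with multipath-or-obstruction D
    ... | inj₁ mp         = mp
    ... | inj₂ (O′ , O′⊆D) =
      ⊥-elim (x∉D (O′⊆D (obstruction-minimal O O′ O′⊆O (Equivalence.to (C≐O x) x∈C))))
      where
      O′⊆O : edges O′ ⊆ edges O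
      O′⊆O {e} e∈O′ = Equivalence.to (C≐O e) (D⊆C (O′⊆D e∈O′))

corollary4p9 : (G : Digraph) → IsMatroid (IsMultipath G) →
    ∀ (C : Subset (m G)) →
      IsCircuit (IsMultipath G) C ⇔
        (IsLinearSink G C ⊎ IsLinearSource G C ⊎ IsCoherentCycle G C)
corollary4p9 G _ C = mk⇔ circuit⇒shape shape⇒circuit
  where open Multipaths G
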